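{- Let $\mathcal{C}$ be a simple binary Boolean VCSP instance on $n$ variables. If the binary Boolean VCSP instance $\mathcal{C}'$ is magnitude-equivalent to $\mathcal{C}$, then $E(\mathcal{C})\subseteq E(\mathcal{C}')$.
   Context: Variables are indexed by $[n]$, each with domain $\{0,1\}$; points are $x\in\{0,1\}^n$. A (valued) constraint with scope $S\subseteq[n]$ is a function $C_S:\{0,1\}^{S}\to\mathbb{Z}$ (scope $\emptyset$ gives a constant). A binary Boolean VCSP instance is a finite set of constraints whose scopes have size at most $2$, with at most one constraint per scope; $C_i$, $C_{ij}$ ($i<j$) denote unary and binary constraints, $C_{ij}(a,b)$ meaning $x_i=a,x_j=b$. The instance implements $f(x)=\sum_{C_S\in\mathcal{C}}C_S(x[S])$. Two instances are magnitude-equivalent if they implement the same fitness function. The constraint graph of an instance $\mathcal{C}$ has vertex set $[n]$ and edge set $E(\mathcal{C})$ consisting of those $\{i,j\}$ for which $\mathcal{C}$ contains a binary constraint with scope $\{i,j\}$ that is not identically zero. An instance is simple if every unary constraint has the form $C_i(0)=0,C_i(1)=c_i$ and every binary constraint has the form $C_{ij}(0,0)=C_{ij}(0,1)=C_{ij}(1,0)=0$, $C_{ij}(1,1)=c_{ij}$ (a constant constraint is allowed). -}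

module Defs where

open import Data.Nat using (ℕ)
open import Data.Bool using (Bool; true; false)
open import Data.Fin using (Fin; _<_; _<?_)
open import Data.List using (List; []; _∷_; map; foldr)
open import Data.List.Base using (allFin)
open import Data.Integer using (ℤ; _+_; 0ℤ)
open import Data.Product using (_×_)
open import Relation.Nullary using (¬_; yes; no)
open import Relation.Binary.PropositionalEquality using (_≡_)

sumℤ : List ℤ → ℤ
sumℤ = foldr _+_ 0ℤ

Σ-Fin : ∀ {n} → (Fin n → ℤ) → ℤ
Σ-Fin {n} f = sumℤ (map f (allFin n))

-- Since there is at most one
-- constraint per scope, an instance is given by one constraint per scope of
-- size ≤ 2, an absent constraint being represented by the identically-zero one
-- (this changes neither the implemented function nor the constraint graph).
-- The binary constraint with scope {i,j}, i < j, is  binary i j  (with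
-- binary i j a b meaning x_i = a, x_j = b); entries with i ≥ j are unused.
record Instance (n : ℕ) : Set where
  field
    const  : ℤ
    unary  : Fin n → Bool → ℤ
    binary : Fin n → Fin n → Bool → Bool → ℤ
open Instance public

Point : ℕ → Set
Point n = Fin n → Bool

pairTerm : ∀ {n} → Instance n → Point n → Fin n → Fin n → ℤ
pairTerm C x i j with i <? j
... | yes _ = binary C i j (x i) (x j)
... | no  _ = 0ℤ

fitness : ∀ {n} → Instance n → Point n → ℤ
fitness C x =
  const C + Σ-Fin (λ i → unary C i (x i))
          + Σ-Fin (λ i → Σ-Fin (λ j → pairTerm C x i j))

MagnitudeEquivalent : ∀ {n} → Instance n → Instance n → Set
MagnitudeEquivalent C C' = ∀ x → fitness C x ≡ fitness C' x

IsSimple : ∀ {n} → Instance n → Set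
IsSimple {n} C =
  (∀ (i : Fin n) → unary C i false ≡ 0ℤ) ×
  (∀ (i j : Fin n) → i < j →
     (binary C i j false false ≡ 0ℤ) ×
     (binary C i j false true  ≡ 0ℤ) ×
     (binary C i j true  false ≡ 0ℤ))

IsEdge : ∀ {n} → Instance n → Fin n → Fin n → Set
IsEdge C i j = i < j × ¬ (∀ a b → binary C i j a b ≡ 0ℤ)

EdgeSubset : ∀ {n} → Instance n → Instance n → Set
EdgeSubset {n} C C' = ∀ (i j : Fin n) → IsEdge C i j → IsEdge C' i j

-- The interaction  f(1,1) − f(1,0) − f(0,1) + f(0,0)  of a fitness function f in
-- the coordinates x_i, x_j (the others fixed) is linear in f and vanishes on every
-- term of an instance that does not depend on both x_i and x_j.  Hence it equals
-- the interaction of the binary constraint C_ij, and so is the same for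
-- magnitude-equivalent instances.  For a simple instance the interaction of C_ij
-- is c_ij, its only possibly nonzero entry; if C'_ij were identically zero, c_ij
-- and therefore all of C_ij would vanish.
module Submission where

open import Defs
open import Data.Nat using (ℕ)
open import Data.Bool using (Bool; true; false)
open import Data.Fin using (Fin; zero; suc; _<_; _<?_; _≟_)
open import Data.Fin.Properties using (<⇒≢; <-asym; suc-injective)
open import Data.List using (List; []; _∷_; map; allFin)
open import Data.List.Properties using (map-tabulate)
open import Function using (_∘_; id)
open import Data.Integer using (ℤ; _+_; _-_; 0ℤ)
open import Data.Integer.Properties using (+-identityˡ; +-identityʳ)
open import Data.Integer.Tactic.RingSolver using (solve-∀)
open import Data.Product using (_×_; _,_; proj₁; proj₂)
open import Data.Sum using (_⊎_; inj₁; inj₂)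
open import Data.Vec.Functional using (updateAt)
open import Data.Vec.Functional.Properties using (updateAt-updates; updateAt-minimal)
open import Relation.Nullary using (¬_; yes; no; contradiction)
open import Relation.Binary.PropositionalEquality

Σ-Fin-suc : ∀ {n} (f : Fin (ℕ.suc n) → ℤ) → Σ-Fin f ≡ f zero + Σ-Fin (f ∘ suc)
Σ-Fin-suc f =
  cong (λ fs → f zero + sumℤ fs) (trans (map-tabulate suc f) (sym (map-tabulate id (f ∘ suc))))

Σ-Fin-zero : ∀ {n} (f : Fin n → ℤ) → (∀ k → f k ≡ 0ℤ) → Σ-Fin f ≡ 0ℤ
Σ-Fin-zero {ℕ.zero}  f f≡0 = refl
Σ-Fin-zero {ℕ.suc n} f f≡0 rewrite Σ-Fin-suc f | f≡0 zero | Σ-Fin-zero (f ∘ suc) (f≡0 ∘ suc) = refl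

Σ-Fin-single : ∀ {n} (f : Fin n → ℤ) (i : Fin n) → (∀ k → k ≢ i → f k ≡ 0ℤ) → Σ-Fin f ≡ f i
Σ-Fin-single f zero f≡0 rewrite Σ-Fin-suc f | Σ-Fin-zero (f ∘ suc) (λ k → f≡0 (suc k) (λ ())) =
  +-identityʳ (f zero)
Σ-Fin-single f (suc i) f≡0
  rewrite Σ-Fin-suc f | f≡0 zero (λ ())
        | Σ-Fin-single (f ∘ suc) i (λ k k≢i → f≡0 (suc k) (k≢i ∘ suc-injective)) =
  +-identityˡ (f (suc i))

interaction : (Bool → Bool → ℤ) → ℤ
interaction c = c true true - c true false - c false true + c false false

interaction-cong : ∀ {c d} → (∀ a b → c a b ≡ d a b) → interaction c ≡ interaction d
interaction-cong c≗d =
  cong₂ _+_ (cong₂ _-_ (cong₂ _-_ (c≗d true true) (c≗d true false)) (c≗d false true))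
            (c≗d false false)

interaction-+ : ∀ c d → interaction (λ a b → c a b + d a b) ≡ interaction c + interaction d
interaction-+ c d = lemma (c true true) (c true false) (c false true) (c false false)
                          (d true true) (d true false) (d false true) (d false false)
  where
  lemma : ∀ p q r s p' q' r' s' →
          (p + p') - (q + q') - (r + r') + (s + s') ≡ (p - q - r + s) + (p' - q' - r' + s')
  lemma = solve-∀

interaction-ignoringˡ : ∀ c → (∀ b → c true b ≡ c false b) → interaction c ≡ 0ℤ
interaction-ignoringˡ c c≗ rewrite c≗ true | c≗ false = lemma (c false true) (c false false)
  where
  lemma : ∀ p q → p - q - p + q ≡ 0ℤ
  lemma = solve-∀

interaction-ignoringʳ : ∀ c → (∀ a → c a true ≡ c a false) → interaction c ≡ 0ℤ
interaction-ignoringʳ c c≗ rewrite c≗ true | c≗ false = lemma (c true false) (c false false)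
  where
  lemma : ∀ p q → p - p - q + q ≡ 0ℤ
  lemma = solve-∀

interaction-simple : ∀ {c} → (c false false ≡ 0ℤ) × (c false true ≡ 0ℤ) × (c true false ≡ 0ℤ) →
                     interaction c ≡ c true true
interaction-simple {c} (c00 , c01 , c10) rewrite c00 | c01 | c10 = lemma (c true true)
  where
  lemma : ∀ p → p - 0ℤ - 0ℤ + 0ℤ ≡ p
  lemma = solve-∀

simple-interaction-zero : ∀ {c} → (c false false ≡ 0ℤ) × (c false true ≡ 0ℤ) × (c true false ≡ 0ℤ) →
                          interaction c ≡ 0ℤ → ∀ a b → c a b ≡ 0ℤ
simple-interaction-zero {c} simple Ic≡0 true  true  = trans (sym (interaction-simple {c} simple)) Ic≡0
simple-interaction-zero (_ , _ , c10) _ true  false = c10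
simple-interaction-zero (_ , c01 , _) _ false true  = c01
simple-interaction-zero (c00 , _ , _) _ false false = c00

DependsOnly : ∀ {n} → Fin n → Fin n → (Point n → ℤ) → Set
DependsOnly k l F = ∀ x y → x k ≡ y k → x l ≡ y l → F x ≡ F y

unaryTerm-dependsOnly : ∀ {n} (C : Instance n) k → DependsOnly k k (λ x → unary C k (x k))
unaryTerm-dependsOnly C k x y xk≡yk _ = cong (unary C k) xk≡yk

pairTerm-ordered : ∀ {n} (C : Instance n) x {k l} → k < l → pairTerm C x k l ≡ binary C k l (x k) (x l)
pairTerm-ordered C x {k} {l} k<l with k <? l
... | yes _   = refl
... | no  k≮l = contradiction k<l k≮l

pairTerm-reversed : ∀ {n} (C : Instance n) x {k l} → l < k → pairTerm C x k l ≡ 0ℤ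
pairTerm-reversed C x {k} {l} l<k with k <? l
... | yes k<l = contradiction k<l (<-asym l<k)
... | no  _   = refl

pairTerm-dependsOnly : ∀ {n} (C : Instance n) k l → DependsOnly k l (λ x → pairTerm C x k l)
pairTerm-dependsOnly C k l x y xk≡yk xl≡yl with k <? l
... | yes _ = cong₂ (binary C k l) xk≡yk xl≡yl
... | no  _ = refl

pair-cases : ∀ {n} {i j k l : Fin n} → i ≢ j →
             (k ≢ i × l ≢ i) ⊎ (k ≢ j × l ≢ j) ⊎ (k ≡ i × l ≡ j) ⊎ (k ≡ j × l ≡ i)
pair-cases {i = i} {j} {k} {l} i≢j with k ≟ i | l ≟ i | k ≟ j | l ≟ j
... | no  k≢i | no  l≢i | _       | _       = inj₁ (k≢i , l≢i)
... | _       | _       | no  k≢j | no  l≢j = inj₂ (inj₁ (k≢j , l≢j))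
... | yes k≡i | _       | _       | yes l≡j = inj₂ (inj₂ (inj₁ (k≡i , l≡j)))
... | _       | yes l≡i | yes k≡j | _       = inj₂ (inj₂ (inj₂ (k≡j , l≡i)))
... | yes k≡i | _       | yes k≡j | _       = contradiction (trans (sym k≡i) k≡j) i≢j
... | _       | yes l≡i | _       | yes l≡j = contradiction (trans (sym l≡i) l≡j) i≢j

module MixedDifference {n} (x : Point n) {i j : Fin n} (i≢j : i ≢ j) where

  point : Bool → Bool → Point n
  point a b = updateAt (updateAt x i (λ _ → a)) j (λ _ → b)

  Δ : (Point n → ℤ) → ℤ
  Δ F = interaction (λ a b → F (point a b))

  point-i : ∀ a b → point a b i ≡ a
  point-i a b = trans (updateAt-minimal i j _ i≢j) (updateAt-updates i x)

  point-j : ∀ a b → point a b j ≡ b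
  point-j a b = updateAt-updates j (updateAt x i (λ _ → a))

  point-ignoresˡ : ∀ {k} a a' b → k ≢ i → point a b k ≡ point a' b k
  point-ignoresˡ {k} a a' b k≢i with k ≟ j
  ... | yes refl = trans (point-j a b) (sym (point-j a' b))
  ... | no k≢j   = begin
    point a b k                   ≡⟨ updateAt-minimal k j _ k≢j ⟩
    updateAt x i (λ _ → a) k      ≡⟨ updateAt-minimal k i x k≢i ⟩
    x k                           ≡⟨ updateAt-minimal k i x k≢i ⟨
    updateAt x i (λ _ → a') k     ≡⟨ updateAt-minimal k j _ k≢j ⟨
    point a' b k                  ∎
    where open ≡-Reasoning

  point-ignoresʳ : ∀ {k} a b b' → k ≢ j → point a b k ≡ point a b' k
  point-ignoresʳ {k} a b b' k≢j =
    trans (updateAt-minimal k j _ k≢j) (sym (updateAt-minimal k j _ k≢j))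

  Δ-cong : ∀ {F G} → (∀ y → F y ≡ G y) → Δ F ≡ Δ G
  Δ-cong F≗G = interaction-cong (λ a b → F≗G (point a b))

  Δ-+ : ∀ F G → Δ (λ y → F y + G y) ≡ Δ F + Δ G
  Δ-+ F G = interaction-+ (λ a b → F (point a b)) (λ a b → G (point a b))

  Δ-const : ∀ c → Δ (λ _ → c) ≡ 0ℤ
  Δ-const c = interaction-ignoringˡ (λ _ _ → c) (λ _ → refl)

  Δ-sum : ∀ {A : Set} (g : Point n → A → ℤ) (as : List A) →
          Δ (λ y → sumℤ (map (g y) as)) ≡ sumℤ (map (λ a → Δ (λ y → g y a)) as)
  Δ-sum g []       = Δ-const 0ℤ
  Δ-sum g (a ∷ as) =
    trans (Δ-+ (λ y → g y a) (λ y → sumℤ (map (g y) as))) (cong (Δ (λ y → g y a) +_) (Δ-sum g as))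

  Δ-Σ-Fin : (g : Point n → Fin n → ℤ) → Δ (λ y → Σ-Fin (g y)) ≡ Σ-Fin (λ k → Δ (λ y → g y k))
  Δ-Σ-Fin g = Δ-sum g (allFin n)

  Δ-ignoring-i : ∀ {k l F} → DependsOnly k l F → k ≢ i → l ≢ i → Δ F ≡ 0ℤ
  Δ-ignoring-i {F = F} dep k≢i l≢i = interaction-ignoringˡ (λ a b → F (point a b))
    (λ b → dep _ _ (point-ignoresˡ true false b k≢i) (point-ignoresˡ true false b l≢i))

  Δ-ignoring-j : ∀ {k l F} → DependsOnly k l F → k ≢ j → l ≢ j → Δ F ≡ 0ℤ
  Δ-ignoring-j {F = F} dep k≢j l≢j = interaction-ignoringʳ (λ a b → F (point a b))
    (λ a → dep _ _ (point-ignoresʳ a true false k≢j) (point-ignoresʳ a true false l≢j))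

  Δ-of-ij : ∀ c → Δ (λ y → c (y i) (y j)) ≡ interaction c
  Δ-of-ij c = interaction-cong (λ a b → cong₂ c (point-i a b) (point-j a b))

  module _ (C : Instance n) where

    Δ-unary : ∀ k → Δ (λ y → unary C k (y k)) ≡ 0ℤ
    Δ-unary k with k ≟ i
    ... | yes refl = Δ-ignoring-j (unaryTerm-dependsOnly C k) i≢j i≢j
    ... | no  k≢i  = Δ-ignoring-i (unaryTerm-dependsOnly C k) k≢i k≢i

    Δ-pairTerm-ij : i < j → Δ (λ y → pairTerm C y i j) ≡ interaction (binary C i j)
    Δ-pairTerm-ij i<j = trans (Δ-cong (λ y → pairTerm-ordered C y i<j)) (Δ-of-ij (binary C i j))

    Δ-pairTerm-off : i < j → ∀ k l → ¬ (k ≡ i × l ≡ j) → Δ (λ y → pairTerm C y k l) ≡ 0ℤ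
    Δ-pairTerm-off i<j k l ¬ij with pair-cases {k = k} {l} i≢j
    ... | inj₁ (k≢i , l≢i)        = Δ-ignoring-i (pairTerm-dependsOnly C k l) k≢i l≢i
    ... | inj₂ (inj₁ (k≢j , l≢j)) = Δ-ignoring-j (pairTerm-dependsOnly C k l) k≢j l≢j
    ... | inj₂ (inj₂ (inj₁ ij))   = contradiction ij ¬ij
    ... | inj₂ (inj₂ (inj₂ (refl , refl))) =
      trans (Δ-cong (λ y → pairTerm-reversed C y i<j)) (Δ-const 0ℤ)

    Δ-fitness : i < j → Δ (fitness C) ≡ interaction (binary C i j)
    Δ-fitness i<j = begin
      Δ (fitness C)
        ≡⟨ Δ-+ (λ y → const C + Σ-Fin (λ k → unary C k (y k))) pairs ⟩
      Δ (λ y → const C + Σ-Fin (λ k → unary C k (y k))) + Δ pairs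
        ≡⟨ cong₂ _+_ Δ-constant-and-unary Δ-pairs ⟩
      0ℤ + interaction (binary C i j)
        ≡⟨ +-identityˡ _ ⟩
      interaction (binary C i j) ∎
      where
      open ≡-Reasoning
      pairs : Point n → ℤ
      pairs y = Σ-Fin (λ k → Σ-Fin (λ l → pairTerm C y k l))

      Δ-constant-and-unary : Δ (λ y → const C + Σ-Fin (λ k → unary C k (y k))) ≡ 0ℤ
      Δ-constant-and-unary = begin
        Δ (λ y → const C + Σ-Fin (λ k → unary C k (y k)))
          ≡⟨ Δ-+ (λ _ → const C) (λ y → Σ-Fin (λ k → unary C k (y k))) ⟩
        Δ (λ _ → const C) + Δ (λ y → Σ-Fin (λ k → unary C k (y k)))
          ≡⟨ cong₂ _+_ (Δ-const (const C)) (Δ-Σ-Fin (λ y k → unary C k (y k))) ⟩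
        0ℤ + Σ-Fin (λ k → Δ (λ y → unary C k (y k)))
          ≡⟨ cong (0ℤ +_) (Σ-Fin-zero _ Δ-unary) ⟩
        0ℤ ∎

      Δ-row : ∀ k → Δ (λ y → Σ-Fin (λ l → pairTerm C y k l)) ≡ Σ-Fin (λ l → Δ (λ y → pairTerm C y k l))
      Δ-row k = Δ-Σ-Fin (λ y l → pairTerm C y k l)

      Δ-pairs : Δ pairs ≡ interaction (binary C i j)
      Δ-pairs = begin
        Δ pairs
          ≡⟨ Δ-Σ-Fin (λ y k → Σ-Fin (λ l → pairTerm C y k l)) ⟩
        Σ-Fin (λ k → Δ (λ y → Σ-Fin (λ l → pairTerm C y k l)))
          ≡⟨ Σ-Fin-single _ i (λ k k≢i → trans (Δ-row k)
               (Σ-Fin-zero _ (λ l → Δ-pairTerm-off i<j k l (k≢i ∘ proj₁)))) ⟩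
        Δ (λ y → Σ-Fin (λ l → pairTerm C y i l))
          ≡⟨ Δ-row i ⟩
        Σ-Fin (λ l → Δ (λ y → pairTerm C y i l))
          ≡⟨ Σ-Fin-single _ j (λ l l≢j → Δ-pairTerm-off i<j i l (l≢j ∘ proj₂)) ⟩
        Δ (λ y → pairTerm C y i j)
          ≡⟨ Δ-pairTerm-ij i<j ⟩
        interaction (binary C i j) ∎

interaction-invariant : ∀ {n} (C C' : Instance n) → MagnitudeEquivalent C C' →
                        ∀ {i j} → i < j → interaction (binary C i j) ≡ interaction (binary C' i j)
interaction-invariant C C' C≈C' {i} {j} i<j = begin
  interaction (binary C i j)   ≡⟨ Δ-fitness C i<j ⟨
  Δ (fitness C)                ≡⟨ Δ-cong C≈C' ⟩
  Δ (fitness C')               ≡⟨ Δ-fitness C' i<j ⟩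
  interaction (binary C' i j)  ∎
  where
  open ≡-Reasoning
  open MixedDifference (λ _ → false) (<⇒≢ i<j)

theorem2 : (n : ℕ) (C C' : Instance n) →
           IsSimple C → MagnitudeEquivalent C C' → EdgeSubset C C'
theorem2 n C C' (_ , binary-simple) C≈C' i j (i<j , C≢0) =
  i<j , λ C'≡0 → C≢0 (simple-interaction-zero (binary-simple i j i<j)
                        (trans (interaction-invariant C C' C≈C' i<j) (interaction-cong C'≡0)))
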